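{- Let $M\subseteq E^n$ be an extended mobile set and $M'\subseteq E^n$ its alternative. Then the sets $R=\{(x,0,0):x\in M\}\cup\{(x,1,1):x\in M'\}$ and $R'=\{(x,1,1):x\in M\}\cup\{(x,0,0):x\in M'\}$ in $E^{n+2}$ are an extended mobile set and its alternative.
   Context: $E^n$ denotes the set of binary words of length $n$ with the Hamming metric $d$; $|x|$ is the sum of coordinates of $x$ modulo $2$. A set $M$ is a $1$-code if the balls of radius $1$ centered at distinct elements of $M$ are pairwise disjoint; $\Omega(M)=\{x:d(x,M)\le1\}$, $\Omega^*(M)=\Omega(M)\setminus M$. A mobile set is a $1$-code $M$ for which there is a $1$-code $M'$ with $M\cap M'=\emptyset$ and $\Omega(M)=\Omega(M')$. The extension of $M\subseteq E^n$ is $\{(x,|x|):x\in M\}$ or $\{(x,|x|\oplus1):x\in M\}$ in $E^{n+1}$; an extended mobile set is the extension of a mobile set. For an extended mobile set $M$, an alternative is a $1$-code $M'$ disjoint from $M$, whose words have the same weight parity as those of $M$, with $\Omega^*(M)=\Omega^*(M')$ (equivalently, puncturing a coordinate turns $M,M'$ into a mobile set and its alternative). -}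

module Defs where

open import Level using (0ℓ)
open import Data.Nat using (ℕ; zero; suc; _+_; _≤_)
open import Data.Bool using (Bool; true; false; _xor_)
open import Data.Vec using (Vec; []; _∷_; _∷ʳ_; foldr)
open import Data.Product using (Σ; _×_; ∃; ∃-syntax)
open import Data.Empty using (⊥)
open import Data.Sum using (_⊎_)
open import Relation.Nullary using (¬_)
open import Relation.Unary using (Pred; _≐_)
open import Relation.Binary.PropositionalEquality using (_≡_)

Word : ℕ → Set
Word n = Vec Bool n

WSet : ℕ → Set₁
WSet n = Pred (Word n) 0ℓ

dist : ∀ {n} → Word n → Word n → ℕ
dist [] [] = 0
dist (a ∷ x) (b ∷ y) = (if' a b) + dist x y
  where
  if' : Bool → Bool → ℕ
  if' a b with a xor b
  ... | true = 1
  ... | false = 0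

parity : ∀ {n} → Word n → Bool
parity = foldr _ _xor_ false

OneCode : ∀ {n} → WSet n → Set
OneCode {n} M = ∀ (x y z : Word n) → M x → M y →
  dist x z ≤ 1 → dist y z ≤ 1 → x ≡ y

Ω : ∀ {n} → WSet n → WSet n
Ω {n} M x = ∃[ y ] (M y × dist x y ≤ 1)

Ω* : ∀ {n} → WSet n → WSet n
Ω* M x = Ω M x × ¬ M x

Disjoint : ∀ {n} → WSet n → WSet n → Set
Disjoint {n} M M' = ∀ (x : Word n) → M x → M' x → ⊥

Mobile : ∀ {n} → WSet n → Set₁
Mobile {n} M = OneCode M × Σ (WSet n) (λ M' → OneCode M' × Disjoint M M' × (Ω M ≐ Ω M'))

-- extension of M ⊆ E^m by appending |x| ⊕ b (b = false: (x,|x|); b = true: (x,|x|⊕1))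
Extension : ∀ {m} → WSet m → Bool → WSet (suc m)
Extension {m} M b w = ∃[ x ] (M x × w ≡ x ∷ʳ (parity x xor b))

ExtendedMobile : ∀ {m} → WSet (suc m) → Set₁
ExtendedMobile {m} M = Σ (WSet m) (λ N → Mobile N × ∃[ b ] (M ≐ Extension N b))

Alternative : ∀ {n} → WSet n → WSet n → Set
Alternative {n} M M' = OneCode M' × Disjoint M M'
  × (∀ (x y : Word n) → M x → M' y → parity x ≡ parity y)
  × (Ω* M ≐ Ω* M')

Glue : ∀ {n} → WSet n → WSet n → WSet (suc (suc n))
Glue {n} A B w = (∃[ x ] (A x × w ≡ x ∷ʳ false ∷ʳ false)) ⊎ (∃[ x ] (B x × w ≡ x ∷ʳ true ∷ʳ true))

-- Puncturing the last coordinate of Glue A B gives Join A B = {(x,0) : x ∈ A} ∪ {(x,1) : x ∈ B},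
-- and since all words of M and M' have the parity b of M, Glue M M' is the extension of Join M M'.
-- Join M M' is a 1-code because words of M and M' are disjoint with equal parity, hence at distance ≥ 2;
-- and a word (w,t) close to (x,t) with x ∈ M is either close to (x,¬t) ∈ Join M' M (if w = x) or has
-- w ∈ Ω*(M) = Ω*(M'), so Ω(Join M M') = Ω(Join M' M).  Finally, extending any mobile set and its partner
-- yields an alternative pair: Ω* of the extension of N consists exactly of the words of parity ¬b
-- whose puncturing lies in Ω(N).
module Submission where

open import Defs
open import Data.Nat using (ℕ; suc; _+_; _≤_; z≤n; s≤s)
open import Data.Nat.Properties using (≤-reflexive; n≤0⇒n≡0; m+n≤o⇒m≤o; +-identityʳ; +-cancelʳ-≤)
open import Data.Bool using (Bool; true; false; not; _xor_)
open import Data.Bool.Properties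
  using (_≟_; not-involutive; not-¬; xor-assoc; xor-comm; not-distribˡ-xor; not-distribʳ-xor)
open import Data.Vec using ([]; _∷_; _∷ʳ_; initLast)
open import Data.Vec.Properties using (∷ʳ-injectiveˡ; ∷ʳ-injectiveʳ; ≡-dec)
open import Data.Product using (_×_; _,_; ∃-syntax)
open import Data.Sum using (_⊎_; inj₁; inj₂; [_,_]′)
import Data.Sum as Sum
open import Data.Empty using (⊥; ⊥-elim)
open import Function using (const; id; _∘_)
open import Relation.Nullary using (yes; no; contradiction)
open import Relation.Unary using (_⊆_; _≐_; _∪_)
open import Relation.Binary.PropositionalEquality hiding ([_])
open ≡-Reasoning

private
  variable
    n : ℕ
    P Q A B N N' : WSet n
    x w : Word n
    b t u : Bool

xor-involutiveˡ : ∀ a b → a xor (a xor b) ≡ b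
xor-involutiveˡ true b = not-involutive b
xor-involutiveˡ false b = refl

dist-refl : ∀ (x : Word n) → dist x x ≡ 0
dist-refl [] = refl
dist-refl (true ∷ x) = dist-refl x
dist-refl (false ∷ x) = dist-refl x

dist-sym : ∀ (x y : Word n) → dist x y ≡ dist y x
dist-sym [] [] = refl
dist-sym (true ∷ x) (true ∷ y) = dist-sym x y
dist-sym (true ∷ x) (false ∷ y) = cong suc (dist-sym x y)
dist-sym (false ∷ x) (true ∷ y) = cong suc (dist-sym x y)
dist-sym (false ∷ x) (false ∷ y) = dist-sym x y

dist≡0⇒≡ : ∀ (x y : Word n) → dist x y ≡ 0 → x ≡ y
dist≡0⇒≡ [] [] _ = refl
dist≡0⇒≡ (true ∷ x) (true ∷ y) e = cong (true ∷_) (dist≡0⇒≡ x y e)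
dist≡0⇒≡ (false ∷ x) (false ∷ y) e = cong (false ∷_) (dist≡0⇒≡ x y e)

dist≤0⇒≡ : ∀ (x y : Word n) → dist x y ≤ 0 → x ≡ y
dist≤0⇒≡ x y d = dist≡0⇒≡ x y (n≤0⇒n≡0 d)

dist-∷ʳ : ∀ (x y : Word n) a b → dist (x ∷ʳ a) (y ∷ʳ b) ≡ dist x y + dist (a ∷ []) (b ∷ [])
dist-∷ʳ [] [] a b = refl
dist-∷ʳ (true ∷ x) (true ∷ y) a b = dist-∷ʳ x y a b
dist-∷ʳ (false ∷ x) (false ∷ y) a b = dist-∷ʳ x y a b
dist-∷ʳ (true ∷ x) (false ∷ y) a b = cong suc (dist-∷ʳ x y a b)
dist-∷ʳ (false ∷ x) (true ∷ y) a b = cong suc (dist-∷ʳ x y a b)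

parity-∷ʳ : ∀ (x : Word n) a → parity (x ∷ʳ a) ≡ parity x xor a
parity-∷ʳ [] a = xor-comm a false
parity-∷ʳ (u ∷ x) a = trans (cong (u xor_) (parity-∷ʳ x a)) (sym (xor-assoc u (parity x) a))

dist-self≤1 : ∀ (x : Word n) → dist x x ≤ 1
dist-self≤1 x = subst (_≤ 1) (sym (dist-refl x)) z≤n

dist≤1⇒≡⊎parity≡not : ∀ (x y : Word n) → dist x y ≤ 1 → x ≡ y ⊎ parity x ≡ not (parity y)
dist≤1⇒≡⊎parity≡not [] [] _ = inj₁ refl
dist≤1⇒≡⊎parity≡not (false ∷ x) (false ∷ y) d =
  Sum.map (cong (false ∷_)) id (dist≤1⇒≡⊎parity≡not x y d)
dist≤1⇒≡⊎parity≡not (true ∷ x) (true ∷ y) d =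
  Sum.map (cong (true ∷_)) (cong not) (dist≤1⇒≡⊎parity≡not x y d)
dist≤1⇒≡⊎parity≡not (false ∷ x) (true ∷ y) (s≤s d) =
  inj₂ (trans (cong parity (dist≤0⇒≡ x y d)) (sym (not-involutive _)))
dist≤1⇒≡⊎parity≡not (true ∷ x) (false ∷ y) (s≤s d) = inj₂ (cong (not ∘ parity) (dist≤0⇒≡ x y d))

dist≤1∧parity≡⇒≡ : ∀ (x y : Word n) → dist x y ≤ 1 → parity x ≡ parity y → x ≡ y
dist≤1∧parity≡⇒≡ x y d p with dist≤1⇒≡⊎parity≡not x y d
... | inj₁ x≡y = x≡y
... | inj₂ p' = contradiction p' (not-¬ p)

neighbour : ∀ (x : Word (suc n)) → ∃[ w ] (dist w x ≤ 1 × w ≢ x)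
neighbour (true ∷ x) = false ∷ x , s≤s (≤-reflexive (dist-refl x)) , λ ()
neighbour (false ∷ x) = true ∷ x , s≤s (≤-reflexive (dist-refl x)) , λ ()

dist-∷ʳ-same : ∀ (x y : Word n) a → dist (x ∷ʳ a) (y ∷ʳ a) ≡ dist x y
dist-∷ʳ-same x y a =
  trans (dist-∷ʳ x y a a) (trans (cong (dist x y +_) (dist-refl (a ∷ []))) (+-identityʳ _))

∷ʳ-dist≤1 : ∀ (x y : Word n) a → dist x y ≤ 1 → dist (x ∷ʳ a) (y ∷ʳ a) ≤ 1
∷ʳ-dist≤1 x y a = subst (_≤ 1) (sym (dist-∷ʳ-same x y a))

∷ʳ-dist≤1⇒dist≤1 : ∀ (x y : Word n) a b → dist (x ∷ʳ a) (y ∷ʳ b) ≤ 1 → dist x y ≤ 1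
∷ʳ-dist≤1⇒dist≤1 x y a b d = m+n≤o⇒m≤o (dist x y) (subst (_≤ 1) (dist-∷ʳ x y a b) d)

∷ʳ-dist≤1-cases : ∀ (x y : Word n) a b → dist (x ∷ʳ a) (y ∷ʳ b) ≤ 1 → (a ≡ b × dist x y ≤ 1) ⊎ x ≡ y
∷ʳ-dist≤1-cases x y true true d = inj₁ (refl , ∷ʳ-dist≤1⇒dist≤1 x y true true d)
∷ʳ-dist≤1-cases x y false false d = inj₁ (refl , ∷ʳ-dist≤1⇒dist≤1 x y false false d)
∷ʳ-dist≤1-cases x y true false d =
  inj₂ (dist≤0⇒≡ x y (+-cancelʳ-≤ 1 _ 0 (subst (_≤ 1) (dist-∷ʳ x y true false) d)))
∷ʳ-dist≤1-cases x y false true d =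
  inj₂ (dist≤0⇒≡ x y (+-cancelʳ-≤ 1 _ 0 (subst (_≤ 1) (dist-∷ʳ x y false true) d)))

∷ʳ-flip-dist≤1 : ∀ (x : Word n) a b → dist (x ∷ʳ a) (x ∷ʳ b) ≤ 1
∷ʳ-flip-dist≤1 x a b =
  subst (_≤ 1) (sym (trans (dist-∷ʳ x x a b) (cong (_+ _) (dist-refl x)))) (bit-dist≤1 a b)
  where
  bit-dist≤1 : ∀ a b → dist (a ∷ []) (b ∷ []) ≤ 1
  bit-dist≤1 true true = z≤n
  bit-dist≤1 true false = s≤s z≤n
  bit-dist≤1 false true = s≤s z≤n
  bit-dist≤1 false false = z≤n

Graph : (Word n → Bool) → WSet n → WSet (suc n)
Graph f P w = ∃[ x ] (P x × w ≡ x ∷ʳ f x)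

Tagged : WSet n → Bool → WSet (suc n)
Tagged P t = Graph (const t) P

Join : WSet n → WSet n → WSet (suc n)
Join A B = Tagged A false ∪ Tagged B true

Apart : WSet n → WSet n → Set
Apart {n} P Q = ∀ (x y : Word n) → P x → Q y → dist x y ≤ 1 → ⊥

DisjointBalls : WSet n → WSet n → Set
DisjointBalls {n} P Q = ∀ (x y z : Word n) → P x → Q y → dist x z ≤ 1 → dist y z ≤ 1 → ⊥

Apart-sym : Apart P Q → Apart Q P
Apart-sym apart y x qy px d = apart x y px qy (subst (_≤ 1) (dist-sym y x) d)

Apart-parity : Disjoint P Q → (∀ x y → P x → Q y → parity x ≡ parity y) → Apart P Q
Apart-parity {Q = Q} disj par x y px qy d =
  disj x px (subst Q (sym (dist≤1∧parity≡⇒≡ x y d (par x y px qy))) qy)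

OneCode-antimono : Q ⊆ P → OneCode P → OneCode Q
OneCode-antimono Q⊆P oc x y z qx qy = oc x y z (Q⊆P qx) (Q⊆P qy)

OneCode-∪ : OneCode P → OneCode Q → DisjointBalls P Q → OneCode (P ∪ Q)
OneCode-∪ ocP ocQ sep x y z (inj₁ px) (inj₁ py) = ocP x y z px py
OneCode-∪ ocP ocQ sep x y z (inj₂ qx) (inj₂ qy) = ocQ x y z qx qy
OneCode-∪ ocP ocQ sep x y z (inj₁ px) (inj₂ qy) dx dy = ⊥-elim (sep x y z px qy dx dy)
OneCode-∪ ocP ocQ sep x y z (inj₂ qx) (inj₁ py) dx dy = ⊥-elim (sep y x z py qx dy dx)

OneCode-Graph : ∀ (f : Word n → Bool) → OneCode P → OneCode (Graph f P)
OneCode-Graph f oc _ _ z (x , px , refl) (y , py , refl) dx dy with initLast z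
... | z₀ , c , refl =
  cong (λ v → v ∷ʳ f v) (oc x y z₀ px py (∷ʳ-dist≤1⇒dist≤1 x z₀ _ c dx) (∷ʳ-dist≤1⇒dist≤1 y z₀ _ c dy))

DisjointBalls-Tagged : Apart P Q → t ≢ u → DisjointBalls (Tagged P t) (Tagged Q u)
DisjointBalls-Tagged {t = t} {u = u} apart t≢u _ _ z (x , px , refl) (y , qy , refl) dx dy with initLast z
... | z₀ , c , refl with ∷ʳ-dist≤1-cases x z₀ t c dx | ∷ʳ-dist≤1-cases y z₀ u c dy
... | inj₁ (refl , _) | inj₁ (refl , _) = t≢u refl
... | inj₁ (_ , dx₀) | inj₂ refl = apart x y px qy dx₀
... | inj₂ refl | inj₁ (_ , dy₀) = Apart-sym apart y x qy px dy₀
... | inj₂ refl | inj₂ refl = apart x x px qy (dist-self≤1 x)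

Join-oneCode : OneCode A → OneCode B → Apart A B → OneCode (Join A B)
Join-oneCode ocA ocB apart =
  OneCode-∪ (OneCode-Graph _ ocA) (OneCode-Graph _ ocB) (DisjointBalls-Tagged apart λ ())

Join-disjoint : Disjoint A B → Disjoint (Join A B) (Join B A)
Join-disjoint {B = B} disj _ (inj₁ (x , ax , refl)) (inj₁ (y , by , e)) =
  disj x ax (subst B (sym (∷ʳ-injectiveˡ x y e)) by)
Join-disjoint {B = B} disj _ (inj₂ (x , bx , refl)) (inj₂ (y , ay , e)) =
  disj y ay (subst B (∷ʳ-injectiveˡ x y e) bx)
Join-disjoint disj _ (inj₁ (x , _ , refl)) (inj₂ (y , _ , e)) = contradiction (∷ʳ-injectiveʳ x y e) λ ()
Join-disjoint disj _ (inj₂ (x , _ , refl)) (inj₁ (y , _ , e)) = contradiction (∷ʳ-injectiveʳ x y e) λ ()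

Ω-mono : P ⊆ Q → Ω P ⊆ Ω Q
Ω-mono P⊆Q (y , py , d) = y , P⊆Q {y} py , d

Ω-∪ : Ω (P ∪ Q) ⊆ Ω P ∪ Ω Q
Ω-∪ (y , inj₁ py , d) = inj₁ (y , py , d)
Ω-∪ (y , inj₂ qy , d) = inj₂ (y , qy , d)

Ω*-resp-≐ : P ≐ Q → Ω* P ⊆ Ω* Q
Ω*-resp-≐ (P⊆Q , Q⊆P) {x} (ω , ¬px) = Ω-mono P⊆Q {x} ω , ¬px ∘ Q⊆P

Ω*-intro : OneCode P → P x → dist w x ≤ 1 → w ≢ x → Ω* P w
Ω*-intro {x = x} {w} oc px d w≢x =
  (x , px , d) , λ pw → w≢x (sym (oc x w w px pw (subst (_≤ 1) (dist-sym w x) d) (dist-self≤1 w)))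

Ω-Tagged : OneCode P → Ω* P ⊆ Ω* Q → Ω (Tagged P t) ⊆ Ω (Tagged Q t) ∪ Ω (Tagged P (not t))
Ω-Tagged {t = t} ocP Ω*P⊆Ω*Q {w} (_ , (x , px , refl) , d) with initLast w
... | w₀ , c , refl with ≡-dec _≟_ w₀ x
...   | yes refl = inj₂ (x ∷ʳ not t , (x , px , refl) , ∷ʳ-flip-dist≤1 x c (not t))
...   | no w₀≢x with ∷ʳ-dist≤1-cases w₀ x c t d
...     | inj₂ w₀≡x = contradiction w₀≡x w₀≢x
...     | inj₁ (refl , d₀) with Ω*P⊆Ω*Q (Ω*-intro ocP px d₀ w₀≢x)
...       | (y , qy , d₁) , _ = inj₁ (y ∷ʳ c , (y , qy , refl) , ∷ʳ-dist≤1 w₀ y c d₁)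

Ω-Join⊆ : OneCode A → OneCode B → Ω* A ⊆ Ω* B → Ω* B ⊆ Ω* A → Ω (Join A B) ⊆ Ω (Join B A)
Ω-Join⊆ ocA ocB Ω*A⊆Ω*B Ω*B⊆Ω*A {w} ω with Ω-∪ {x = w} ω
... | inj₁ ωA = [ Ω-mono inj₁ {w} , Ω-mono inj₂ {w} ]′ (Ω-Tagged ocA Ω*A⊆Ω*B {w} ωA)
... | inj₂ ωB = [ Ω-mono inj₂ {w} , Ω-mono inj₁ {w} ]′ (Ω-Tagged ocB Ω*B⊆Ω*A {w} ωB)

Ω-Join≐ : OneCode A → OneCode B → Ω* A ≐ Ω* B → Ω (Join A B) ≐ Ω (Join B A)
Ω-Join≐ ocA ocB (Ω*A⊆Ω*B , Ω*B⊆Ω*A) =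
  (λ {w} → Ω-Join⊆ ocA ocB Ω*A⊆Ω*B Ω*B⊆Ω*A {w}) , (λ {w} → Ω-Join⊆ ocB ocA Ω*B⊆Ω*A Ω*A⊆Ω*B {w})

Extension-parity : Extension N b w → parity w ≡ b
Extension-parity {b = b} (x , _ , refl) = trans (parity-∷ʳ x _) (xor-involutiveˡ (parity x) b)

Extension-disjoint : Disjoint N N' → Disjoint (Extension N b) (Extension N' b)
Extension-disjoint {N' = N'} disj _ (x , nx , refl) (y , n'y , e) =
  disj x nx (subst N' (sym (∷ʳ-injectiveˡ x y e)) n'y)

Ω*-Extension⁺ : ∀ (z : Word n) c → Ω* (Extension N b) (z ∷ʳ c) → parity (z ∷ʳ c) ≡ not b × Ω N z
Ω*-Extension⁺ {N = N} z c ((_ , (x , nx , refl) , d) , ¬ext) with dist≤1⇒≡⊎parity≡not (z ∷ʳ c) (x ∷ʳ _) d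
... | inj₁ e = contradiction (x , nx , e) ¬ext
... | inj₂ p =
  trans p (cong not (Extension-parity {N = N} (x , nx , refl))) , (x , nx , ∷ʳ-dist≤1⇒dist≤1 z x c _ d)

Ω*-Extension⁻ : ∀ (z : Word n) c → parity (z ∷ʳ c) ≡ not b → Ω N z → Ω* (Extension N b) (z ∷ʳ c)
Ω*-Extension⁻ {b = b} z c odd (x , nx , d) =
  (x ∷ʳ (parity x xor b) , (x , nx , refl) , near) , λ ext → not-¬ (Extension-parity ext) odd
  where
  near : dist (z ∷ʳ c) (x ∷ʳ (parity x xor b)) ≤ 1
  near with dist≤1⇒≡⊎parity≡not x z (subst (_≤ 1) (dist-sym z x) d)
  ... | inj₁ refl = ∷ʳ-flip-dist≤1 x c _
  ... | inj₂ px≡not-pz = subst (λ a → dist (z ∷ʳ c) (x ∷ʳ a) ≤ 1) c≡ (∷ʳ-dist≤1 z x c d)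
    where
    c≡ : c ≡ parity x xor b
    c≡ = begin
      c                             ≡⟨ sym (xor-involutiveˡ (parity z) c) ⟩
      parity z xor (parity z xor c) ≡⟨ cong (parity z xor_) (trans (sym (parity-∷ʳ z c)) odd) ⟩
      parity z xor not b            ≡⟨ sym (not-distribʳ-xor (parity z) b) ⟩
      not (parity z xor b)          ≡⟨ not-distribˡ-xor (parity z) b ⟩
      not (parity z) xor b          ≡⟨ cong (_xor b) (sym px≡not-pz) ⟩
      parity x xor b                ∎

Ω*-Extension-mono : Ω N ⊆ Ω N' → Ω* (Extension N b) ⊆ Ω* (Extension N' b)
Ω*-Extension-mono ΩN⊆ΩN' {w} ω with initLast w
... | z , c , refl with Ω*-Extension⁺ z c ω
... | odd , ωz = Ω*-Extension⁻ z c odd (ΩN⊆ΩN' {z} ωz)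

Extension-alternative : OneCode N' → Disjoint N N' → Ω N ≐ Ω N' →
  Alternative (Extension N b) (Extension N' b)
Extension-alternative ocN' disj (ΩN⊆ΩN' , ΩN'⊆ΩN) =
    OneCode-Graph _ ocN'
  , Extension-disjoint disj
  , (λ x y ex ey → trans (Extension-parity ex) (sym (Extension-parity ey)))
  , Ω*-Extension-mono (λ {z} → ΩN⊆ΩN' {z})
  , Ω*-Extension-mono (λ {z} → ΩN'⊆ΩN {z})

Alternative-resp-≐ : ∀ {P P₀ Q Q₀ : WSet n} → P ≐ P₀ → Q ≐ Q₀ → Alternative P₀ Q₀ → Alternative P Q
Alternative-resp-≐ (P⊆P₀ , P₀⊆P) (Q⊆Q₀ , Q₀⊆Q) (ocQ₀ , disj , par , Ω*P₀⊆Ω*Q₀ , Ω*Q₀⊆Ω*P₀) =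
    OneCode-antimono Q⊆Q₀ ocQ₀
  , (λ x px qx → disj x (P⊆P₀ px) (Q⊆Q₀ qx))
  , (λ x y px qy → par x y (P⊆P₀ px) (Q⊆Q₀ qy))
  , (λ ω → Ω*-resp-≐ (Q₀⊆Q , Q⊆Q₀) (Ω*P₀⊆Ω*Q₀ (Ω*-resp-≐ (P⊆P₀ , P₀⊆P) ω)))
  , (λ ω → Ω*-resp-≐ (P₀⊆P , P⊆P₀) (Ω*Q₀⊆Ω*P₀ (Ω*-resp-≐ (Q⊆Q₀ , Q₀⊆Q) ω)))

Alternative-parity : (∀ {x} → P x → parity x ≡ b) → Alternative P Q →
  ∀ {y : Word (suc n)} → Q y → parity y ≡ b
Alternative-parity parP (ocQ , _ , par , _ , Ω*Q⊆Ω*P) {y} qy with neighbour y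
... | w , d , w≢y with Ω*Q⊆Ω*P (Ω*-intro ocQ qy d w≢y)
... | (x , px , _) , _ = trans (sym (par x y px qy)) (parP px)

∷ʳ-repeat≡∷ʳ-parity : ∀ (x : Word n) t → parity x ≡ b →
  x ∷ʳ t ∷ʳ t ≡ (x ∷ʳ t) ∷ʳ (parity (x ∷ʳ t) xor b)
∷ʳ-repeat≡∷ʳ-parity {b = b} x t px≡b = cong (x ∷ʳ t ∷ʳ_) (sym (begin
  parity (x ∷ʳ t) xor b  ≡⟨ xor-comm _ b ⟩
  b xor parity (x ∷ʳ t)  ≡⟨ cong (b xor_) (parity-∷ʳ x t) ⟩
  b xor (parity x xor t) ≡⟨ cong (λ p → b xor (p xor t)) px≡b ⟩
  b xor (b xor t)        ≡⟨ xor-involutiveˡ b t ⟩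
  t                      ∎))

Glue≐Extension-Join : (∀ {x} → A x → parity x ≡ b) → (∀ {x} → B x → parity x ≡ b) →
  Glue A B ≐ Extension (Join A B) b
Glue≐Extension-Join parA parB =
    (λ { (inj₁ (x , ax , refl)) → x ∷ʳ false , inj₁ (x , ax , refl) , ∷ʳ-repeat≡∷ʳ-parity x false (parA ax)
       ; (inj₂ (x , bx , refl)) → x ∷ʳ true , inj₂ (x , bx , refl) , ∷ʳ-repeat≡∷ʳ-parity x true (parB bx) })
  , (λ { (_ , inj₁ (x , ax , refl) , refl) → inj₁ (x , ax , sym (∷ʳ-repeat≡∷ʳ-parity x false (parA ax)))
       ; (_ , inj₂ (x , bx , refl) , refl) → inj₂ (x , bx , sym (∷ʳ-repeat≡∷ʳ-parity x true (parB bx))) })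

lemma3 : ∀ (m : ℕ) (M M' : WSet (suc m)) → ExtendedMobile M → Alternative M M' →
    ExtendedMobile (Glue M M') × Alternative (Glue M M') (Glue M' M)
lemma3 m M M' (N , (ocN , _) , b , M⊆ExtN , _) alt@(ocM' , disj , par , Ω*M≐Ω*M') =
    (Join M M' , (ocJ , Join M' M , ocJ' , disjJ , ΩJ≐ΩJ') , b , Glue≐Extension-Join parM parM')
  , Alternative-resp-≐ (Glue≐Extension-Join parM parM') (Glue≐Extension-Join parM' parM)
      (Extension-alternative ocJ' disjJ ΩJ≐ΩJ')
  where
  ocM : OneCode M
  ocM = OneCode-antimono M⊆ExtN (OneCode-Graph _ ocN)
  parM : ∀ {x} → M x → parity x ≡ b
  parM mx = Extension-parity (M⊆ExtN mx)
  parM' : ∀ {x} → M' x → parity x ≡ b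
  parM' = Alternative-parity parM alt
  apart : Apart M M'
  apart = Apart-parity disj par
  ocJ : OneCode (Join M M')
  ocJ = Join-oneCode ocM ocM' apart
  ocJ' : OneCode (Join M' M)
  ocJ' = Join-oneCode ocM' ocM (Apart-sym apart)
  disjJ : Disjoint (Join M M') (Join M' M)
  disjJ = Join-disjoint disj
  ΩJ≐ΩJ' : Ω (Join M M') ≐ Ω (Join M' M)
  ΩJ≐ΩJ' = Ω-Join≐ ocM ocM' Ω*M≐Ω*M'
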